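{- Let $x$ be a positive rational number and let $x_0,x_1,\dots,x_k$ be its minimal partition. Write $x_j=p'_j/q'_j$ with $\gcd(p'_j,q'_j)=1$ and $q'_j\ge0$. Then: (i) $x<\dfrac{p'_{j-1}-p'_j}{q'_{j-1}-q'_j}$ for $j=1,2,\dots,k$; (ii) $\left\lceil\dfrac{xq'_{j+1}-p'_{j+1}}{xq'_j-p'_j}\right\rceil=p'_{j-1}q'_{j+1}-p'_{j+1}q'_{j-1}$ for $j=1,2,\dots,k-1$.
   Context: Conventions. Elements of $\mathbb Q\cup\{ -\infty\}$ are written as $p/q$ with $\gcd(p,q)=1$ and $q\ge0$; in particular $-\infty=\frac{ -1}{0}$ and $0=\frac01$. Minimal partition. A minimal partition of $x>0$ is a sequence $x_0=x,x_1,\dots,x_k=-\infty$ such that: - $p'_{j-1}q'_j-p'_jq'_{j-1}=1$ for $j=1,\dots,k$; - $q'_0>q'_1>\dots>q'_k=0$. It exists and is unique. $\lceil r\rceil$ denotes the integer with $\lceil r\rceil-1<r\le\lceil r\rceil$. -}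

module Defs where

open import Data.Nat using (ℕ; suc; _≤_; _>_)
open import Data.Nat.Coprimality using (Coprime)
open import Data.Integer using (ℤ; ∣_∣; +_; -_; _*_; _-_)
open import Data.Rational using (ℚ; 0ℚ; _÷_; _≟_; ≢-nonZero; ↥_; ↧ₙ_)
open import Relation.Nullary using (yes; no)
open import Relation.Binary.PropositionalEquality using (_≡_)

-- Total division on ℚ (returns 0 when the divisor is 0); in the statement
-- it is only applied to divisors that are nonzero under the hypotheses.
_÷'_ : ℚ → ℚ → ℚ
a ÷' b with b ≟ 0ℚ
... | yes _ = 0ℚ
... | no b≢0 = _÷_ a b {{≢-nonZero b≢0}}

ℤ→ℚ : ℤ → ℚ
ℤ→ℚ n = Data.Rational._/_ n 1

-- x_0, ..., x_k is a minimal partition of x, given through the reduced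
-- representations x_j = p j / q j (gcd(|p j|, q j) = 1, q j ≥ 0 as q j : ℕ),
-- with -∞ = -1/0. Only indices 0..k are relevant.
--   x_0 = x, x_k = -∞,
--   p_{j-1} q_j - p_j q_{j-1} = 1 for j = 1..k,
--   q_0 > q_1 > ... > q_k = 0.
record MinimalPartition (x : ℚ) (k : ℕ) (p : ℕ → ℤ) (q : ℕ → ℕ) : Set where
  field
    reduced : ∀ j → j ≤ k → Coprime ∣ p j ∣ (q j)
    start-p : p 0 ≡ ↥ x
    start-q : q 0 ≡ ↧ₙ x
    end-p   : p k ≡ - (+ 1)
    end-q   : q k ≡ 0
    det     : ∀ i → suc i ≤ k → p i * (+ q (suc i)) - p (suc i) * (+ q i) ≡ + 1
    decr    : ∀ i → suc i ≤ k → q i > q (suc i)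

{-# OPTIONS --safe #-}
module Submission where

-- Write vⱼ = (p′ⱼ, q′ⱼ). Consecutive vectors have determinant 1, so Cramer's rule gives
-- vⱼ₋₁ + vⱼ₊₁ = cⱼ vⱼ with cⱼ = det (vⱼ₋₁, vⱼ₊₁), and cⱼ ≥ 2 because q′ⱼ₋₁ > q′ⱼ.
-- Hence Dⱼ = ↧x (x q′ⱼ − p′ⱼ) = det ((↥x, ↧x), vⱼ) obeys the same recurrence; it starts with
-- D₀ = 0, D₁ = 1, so it is nonnegative and strictly increasing. Part (i) is Dⱼ₋₁ < Dⱼ after
-- cross-multiplication, and (ii) follows from Dⱼ₊₁ / Dⱼ = cⱼ − Dⱼ₋₁ / Dⱼ with 0 ≤ Dⱼ₋₁ < Dⱼ.

open import Defs
open import Data.Nat using (ℕ; suc; zero)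
import Data.Nat as ℕ
import Data.Nat.Properties as ℕ

module IntegerProperties where
  open import Data.Integer renaming (suc to sucℤ)
  open import Data.Integer.Properties
  open import Data.Integer.DivMod using (div-pos-is-/ℕ; [n/d]*d≤n; n<s[n/ℕd]*d)
  open import Data.Integer.Tactic.RingSolver using (solve-∀)
  open import Data.Product using (_×_; _,_)
  open import Function using (_∘′_)
  open import Relation.Binary.PropositionalEquality

  det₂ : ℤ → ℤ → ℤ → ℤ → ℤ
  det₂ p q p′ q′ = p * q′ - p′ * q

  cramerᵖ : ∀ p₀ q₀ p₁ q₁ p₂ q₂ →
            (p₁ * q₂ - p₂ * q₁) * p₀ + (p₀ * q₁ - p₁ * q₀) * p₂ ≡ (p₀ * q₂ - p₂ * q₀) * p₁
  cramerᵖ = solve-∀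

  cramerᵠ : ∀ p₀ q₀ p₁ q₁ p₂ q₂ →
            (p₁ * q₂ - p₂ * q₁) * q₀ + (p₀ * q₁ - p₁ * q₀) * q₂ ≡ (p₀ * q₂ - p₂ * q₀) * q₁
  cramerᵠ = solve-∀

  three-term : ∀ p₀ q₀ p₁ q₁ p₂ q₂ → det₂ p₀ q₀ p₁ q₁ ≡ 1ℤ → det₂ p₁ q₁ p₂ q₂ ≡ 1ℤ →
               (p₀ + p₂ ≡ det₂ p₀ q₀ p₂ q₂ * p₁) × (q₀ + q₂ ≡ det₂ p₀ q₀ p₂ q₂ * q₁)
  three-term p₀ q₀ p₁ q₁ p₂ q₂ d₀₁ d₁₂ =
    at-unit-determinants (cramerᵖ p₀ q₀ p₁ q₁ p₂ q₂) , at-unit-determinants (cramerᵠ p₀ q₀ p₁ q₁ p₂ q₂)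
    where
    open ≡-Reasoning
    at-unit-determinants : ∀ {r₀ r₂ c} →
                           det₂ p₁ q₁ p₂ q₂ * r₀ + det₂ p₀ q₀ p₁ q₁ * r₂ ≡ c → r₀ + r₂ ≡ c
    at-unit-determinants {r₀} {r₂} {c} cramer = begin
      r₀ + r₂                                        ≡⟨ cong₂ _+_ (*-identityˡ r₀) (*-identityˡ r₂) ⟨
      1ℤ * r₀ + 1ℤ * r₂                              ≡⟨ cong₂ (λ s t → s * r₀ + t * r₂) d₁₂ d₀₁ ⟨
      det₂ p₁ q₁ p₂ q₂ * r₀ + det₂ p₀ q₀ p₁ q₁ * r₂  ≡⟨ cramer ⟩
      c                                              ∎

  +-cancelˡ-< : ∀ i {j k} → i + j < i + k → j < k
  +-cancelˡ-< i {j} {k} = subst₂ _<_ (-i+[i+j]≡j j) (-i+[i+j]≡j k) ∘′ +-monoʳ-< (- i)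
    where
    -i+[i+j]≡j : ∀ j → - i + (i + j) ≡ j
    -i+[i+j]≡j j = trans (sym (+-assoc (- i) i j)) (trans (cong (_+ j) (+-inverseˡ i)) (+-identityˡ j))

  i<j⇒0<j-i : ∀ {i j} → i < j → 0ℤ < j - i
  i<j⇒0<j-i {i} {j} i<j = subst (_< j - i) (+-inverseʳ i) (+-monoˡ-< (- i) i<j)

  recurrence-increasing : ∀ {d₀ d₁ d₂ c} → + 2 ≤ c → 0ℤ ≤ d₀ → d₀ < d₁ → d₀ + d₂ ≡ c * d₁ → d₁ < d₂
  recurrence-increasing {d₀} {d₁} {d₂} {c} 2≤c 0≤d₀ d₀<d₁ rec = +-cancelˡ-< d₀ (begin-strict
    d₀ + d₁       <⟨ +-monoˡ-< d₁ d₀<d₁ ⟩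
    d₁ + d₁       ≡⟨ cong (_+_ d₁) (*-identityˡ d₁) ⟨
    d₁ + 1ℤ * d₁  ≡⟨ suc-* 1ℤ d₁ ⟨
    + 2 * d₁      ≤⟨ *-monoʳ-≤-nonNeg d₁ {{nonNegative (≤-trans 0≤d₀ (<⇒≤ d₀<d₁))}} 2≤c ⟩
    c * d₁        ≡⟨ rec ⟨
    d₀ + d₂       ∎)
    where open ≤-Reasoning

  /-unique : ∀ n d .{{_ : ℕ.NonZero d}} f t → n ≡ f * + d + t → 0ℤ ≤ t → t < + d → n / + d ≡ f
  /-unique n d f t n≡ 0≤t t<d =
    ≤-antisym (below ([n/d]*d≤n n (+ d)) n<suc[f]*d) (below f*d≤n n<suc[n/d]*d)
    where
    open ≤-Reasoning
    below : ∀ {f g} → f * + d ≤ n → n < sucℤ g * + d → f ≤ g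
    below {f} {g} lo hi = subst (f ≤_) (pred-suc g)
      (i<j⇒i≤pred[j] (*-cancelʳ-<-nonNeg {f} {sucℤ g} (+ d) (≤-<-trans lo hi)))
    n<suc[n/d]*d : n < sucℤ (n / + d) * + d
    n<suc[n/d]*d = subst (λ g → n < sucℤ g * + d) (sym (div-pos-is-/ℕ n d)) (n<s[n/ℕd]*d n d)
    f*d≤n : f * + d ≤ n
    f*d≤n = begin
      f * + d       ≤⟨ i≤i+j (f * + d) t {{nonNegative 0≤t}} ⟩
      f * + d + t   ≡⟨ n≡ ⟨
      n             ∎
    n<suc[f]*d : n < sucℤ f * + d
    n<suc[f]*d = begin-strict
      n              ≡⟨ n≡ ⟩
      f * + d + t    <⟨ +-monoʳ-< (f * + d) t<d ⟩
      f * + d + + d  ≡⟨ +-comm (f * + d) (+ d) ⟩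
      + d + f * + d  ≡⟨ suc-* f (+ d) ⟨
      sucℤ f * + d   ∎

open IntegerProperties

module RationalProperties where
  open import Data.Integer hiding (suc)
  open import Data.Integer.Properties
  open import Data.Integer.Tactic.RingSolver using (solve-∀)
  open import Data.Rational as ℚ using (mkℚ; 0ℚ; ↥_; ↧_; ↧ₙ_; toℚᵘ; floor; ceiling)
  open import Data.Rational.Properties as ℚ using (↥-neg; ↧-neg)
  open import Data.Rational.Unnormalised as ℚᵘ using (mkℚᵘ; *≡*; _≃_)
  import Data.Rational.Unnormalised.Properties as ℚᵘ
  open import Data.Empty using (⊥-elim)
  open import Relation.Binary.PropositionalEquality
  open import Relation.Nullary using (yes; no)
  open import Algebra.Properties.CommutativeSemigroup *-commutativeSemigroup using (xy∙z≈xz∙y)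

  a÷'b*b≡a : ∀ a b → b ≢ 0ℚ → (a ÷' b) ℚ.* b ≡ a
  a÷'b*b≡a a b b≢0 with b ℚ.≟ 0ℚ
  ... | yes b≡0 = ⊥-elim (b≢0 b≡0)
  ... | no b≢0′ = begin
    a ℚ.* ℚ.1/ b ℚ.* b    ≡⟨ ℚ.*-assoc a (ℚ.1/ b) b ⟩
    a ℚ.* (ℚ.1/ b ℚ.* b)  ≡⟨ cong (a ℚ.*_) (ℚ.*-inverseˡ b) ⟩
    a ℚ.* ℚ.1ℚ            ≡⟨ ℚ.*-identityʳ a ⟩
    a                     ∎
    where
    open ≡-Reasoning
    instance _ = ℚ.≢-nonZero b≢0′

  r*[n/d]≃m/d⇒↥r*n≡m*↧r : ∀ r {m n d} .{{_ : ℕ.NonZero d}} →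
                           toℚᵘ r ℚᵘ.* (n ℚᵘ./ d) ≃ m ℚᵘ./ d → ↥ r * n ≡ m * ↧ r
  r*[n/d]≃m/d⇒↥r*n≡m*↧r (mkℚ s d-1 _) {m} {n} {suc d-1′} (*≡* eq) =
    *-cancelʳ-≡ (s * n) (m * + suc d-1) (+ suc d-1′) (begin
      s * n * + suc d-1′            ≡⟨ eq ⟩
      m * + (suc d-1 ℕ.* suc d-1′)  ≡⟨ cong (m *_) (pos-* (suc d-1) (suc d-1′)) ⟩
      m * (+ suc d-1 * + suc d-1′)  ≡⟨ *-assoc m (+ suc d-1) (+ suc d-1′) ⟨
      m * + suc d-1 * + suc d-1′    ∎)
    where open ≡-Reasoning

  ÷'-cross : ∀ a b {m n d} .{{_ : ℕ.NonZero d}} →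
             toℚᵘ a ≃ m ℚᵘ./ d → toℚᵘ b ≃ n ℚᵘ./ d → n ≢ 0ℤ → ↥ (a ÷' b) * n ≡ m * ↧ (a ÷' b)
  ÷'-cross a b {m} {n} {d@(suc _)} a≃ b≃ n≢0 = r*[n/d]≃m/d⇒↥r*n≡m*↧r (a ÷' b) (begin
    toℚᵘ (a ÷' b) ℚᵘ.* (n ℚᵘ./ d)  ≈⟨ ℚᵘ.*-congˡ {toℚᵘ (a ÷' b)} (ℚᵘ.≃-sym b≃) ⟩
    toℚᵘ (a ÷' b) ℚᵘ.* toℚᵘ b      ≈⟨ ℚ.toℚᵘ-homo-* (a ÷' b) b ⟨
    toℚᵘ ((a ÷' b) ℚ.* b)          ≡⟨ cong toℚᵘ (a÷'b*b≡a a b b≢0) ⟩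
    toℚᵘ a                         ≈⟨ a≃ ⟩
    m ℚᵘ./ d                       ∎)
    where
    open ℚᵘ.≃-Reasoning
    b≢0 : b ≢ 0ℚ
    b≢0 b≡0 with subst (λ c → toℚᵘ c ≃ n ℚᵘ./ d) b≡0 b≃
    b≢0 b≡0 | *≡* 0≡n*1 = n≢0 (trans (sym (*-identityʳ n)) (sym 0≡n*1))

  toℚᵘ-ℤ→ℚ : ∀ n → toℚᵘ (ℤ→ℚ n) ≃ n ℚᵘ./ 1
  toℚᵘ-ℤ→ℚ n = ℚ.toℚᵘ-fromℚᵘ (n ℚᵘ./ 1)

  toℚᵘ-affine : ∀ x i j → toℚᵘ (x ℚ.* ℤ→ℚ i ℚ.- ℤ→ℚ j) ≃ (↥ x * i - j * ↧ x) ℚᵘ./ ↧ₙ x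
  toℚᵘ-affine x@(mkℚ n d-1 _) i j = begin
    toℚᵘ (x ℚ.* ℤ→ℚ i ℚ.- ℤ→ℚ j)              ≈⟨ ℚ.toℚᵘ-homo-+ (x ℚ.* ℤ→ℚ i) (ℚ.- ℤ→ℚ j) ⟩
    toℚᵘ (x ℚ.* ℤ→ℚ i) ℚᵘ.+ toℚᵘ (ℚ.- ℤ→ℚ j)  ≈⟨ ℚᵘ.+-cong x*i -j ⟩
    L                                         ≈⟨ *≡* (cong₂ _*_ ↥L (sym ↧L)) ⟩
    (n * i - j * + suc d-1) ℚᵘ./ suc d-1      ∎
    where
    open ℚᵘ.≃-Reasoning
    regroup : ∀ a b c → a * 1ℤ + - b * c ≡ a - b * c
    regroup = solve-∀
    L = toℚᵘ x ℚᵘ.* (i ℚᵘ./ 1) ℚᵘ.- j ℚᵘ./ 1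
    x*i : toℚᵘ (x ℚ.* ℤ→ℚ i) ≃ toℚᵘ x ℚᵘ.* (i ℚᵘ./ 1)
    x*i = ℚᵘ.≃-trans (ℚ.toℚᵘ-homo-* x (ℤ→ℚ i)) (ℚᵘ.*-congˡ {toℚᵘ x} (toℚᵘ-ℤ→ℚ i))
    -j : toℚᵘ (ℚ.- ℤ→ℚ j) ≃ ℚᵘ.- (j ℚᵘ./ 1)
    -j = ℚᵘ.≃-trans (ℚ.toℚᵘ-homo‿- (ℤ→ℚ j)) (ℚᵘ.-‿cong (toℚᵘ-ℤ→ℚ j))
    ↥L : ℚᵘ.↥ L ≡ n * i - j * + suc d-1
    ↥L rewrite ℕ.*-identityʳ d-1 = regroup (n * i) j (+ suc d-1)
    ↧L : ℚᵘ.↧ L ≡ + suc d-1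
    ↧L = cong (λ d → + suc d) (trans (ℕ.*-identityʳ (d-1 ℕ.* 1)) (ℕ.*-identityʳ d-1))

  <-cross : ∀ x y {m n} → 0ℤ < n → ↥ y * n ≡ m * ↧ y → ↥ x * n < m * ↧ x → x ℚ.< y
  <-cross x@record{} y@record{} {m} {n} 0<n cross x<m/n =
    ℚ.*<* (*-cancelʳ-<-nonNeg n {{nonNegative (<⇒≤ 0<n)}} (begin-strict
      ↥ x * ↧ y * n  ≡⟨ xy∙z≈xz∙y (↥ x) (↧ y) n ⟩
      ↥ x * n * ↧ y  <⟨ *-monoʳ-<-pos (↧ y) x<m/n ⟩
      m * ↧ x * ↧ y  ≡⟨ xy∙z≈xz∙y m (↧ x) (↧ y) ⟩
      m * ↧ y * ↧ x  ≡⟨ cong (_* ↧ x) cross ⟨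
      ↥ y * n * ↧ x  ≡⟨ xy∙z≈xz∙y (↥ y) n (↧ x) ⟩
      ↥ y * ↧ x * n  ∎))
    where open ≤-Reasoning

  floor-unique : ∀ r f t → ↥ r ≡ f * ↧ r + t → 0ℤ ≤ t → t < ↧ r → floor r ≡ f
  floor-unique (mkℚ n d-1 _) = /-unique n (suc d-1)

  ceiling-cross : ∀ r {a b e} c → ↥ r * b ≡ a * ↧ r → a + e ≡ c * b → 0ℤ ≤ e → e < b →
                  ceiling r ≡ c
  ceiling-cross r@record{} {a} {b} {e} c cross split 0≤e e<b = begin-equality
    - floor (ℚ.- r)  ≡⟨ cong -_ (floor-unique (ℚ.- r) (- c) t ↥[-r]≡-c*↧[-r]+t 0≤t t<↧[-r]) ⟩
    - - c            ≡⟨ neg-involutive c ⟩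
    c                ∎
    where
    open ≤-Reasoning
    distrib : ∀ c m n b → (c * m - n) * b ≡ c * b * m - n * b
    distrib = solve-∀
    cancel-a : ∀ a e m → (a + e) * m - a * m ≡ e * m
    cancel-a = solve-∀
    split-neg : ∀ c m n → - n ≡ - c * m + (c * m - n)
    split-neg = solve-∀
    -- Since r = c − e / b, the remainder t = ↧ r · e / b lies in [0, ↧ r).
    t : ℤ
    t = c * ↧ r - ↥ r
    0<b : 0ℤ < b
    0<b = ≤-<-trans 0≤e e<b
    t*b≡e*↧r : t * b ≡ e * ↧ r
    t*b≡e*↧r = begin-equality
      t * b                    ≡⟨ distrib c (↧ r) (↥ r) b ⟩
      c * b * ↧ r - ↥ r * b    ≡⟨ cong₂ (λ u v → u * ↧ r - v) split (sym cross) ⟨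
      (a + e) * ↧ r - a * ↧ r  ≡⟨ cancel-a a e (↧ r) ⟩
      e * ↧ r                  ∎
    0≤t : 0ℤ ≤ t
    0≤t = *-cancelʳ-≤-pos 0ℤ t b {{positive 0<b}} (begin
      0ℤ * ↧ r  ≤⟨ *-monoʳ-≤-nonNeg (↧ r) 0≤e ⟩
      e * ↧ r   ≡⟨ t*b≡e*↧r ⟨
      t * b     ∎)
    t<↧[-r] : t < ↧ (ℚ.- r)
    t<↧[-r] = subst (t <_) (sym (↧-neg r)) (*-cancelʳ-<-nonNeg b {{nonNegative (<⇒≤ 0<b)}} (begin-strict
      t * b    ≡⟨ t*b≡e*↧r ⟩
      e * ↧ r  <⟨ *-monoʳ-<-pos (↧ r) e<b ⟩
      b * ↧ r  ≡⟨ *-comm b (↧ r) ⟩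
      ↧ r * b  ∎))
    ↥[-r]≡-c*↧[-r]+t : ↥ (ℚ.- r) ≡ - c * ↧ (ℚ.- r) + t
    ↥[-r]≡-c*↧[-r]+t = begin-equality
      ↥ (ℚ.- r)            ≡⟨ ↥-neg r ⟩
      - ↥ r                ≡⟨ split-neg c (↧ r) (↥ r) ⟩
      - c * ↧ r + t        ≡⟨ cong (λ d → - c * d + t) (↧-neg r) ⟨
      - c * ↧ (ℚ.- r) + t  ∎

open RationalProperties

module MinimalPartitionProperties {x k p q} (mp : MinimalPartition x k p q) where
  open MinimalPartition mp
  open import Data.Integer hiding (suc)
  open import Data.Integer.Properties
  open import Data.Integer.Tactic.RingSolver using (solve-∀)
  open import Data.Rational as ℚ using (↥_; ↧_; ceiling)
  open import Data.Product using (_×_; _,_; proj₁; proj₂)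
  open import Relation.Binary.PropositionalEquality

  Q : ℕ → ℤ
  Q j = + q j

  c : ℕ → ℤ
  c i = det₂ (p i) (Q i) (p (suc (suc i))) (Q (suc (suc i)))

  D : ℕ → ℤ
  D j = det₂ (↥ x) (↧ x) (p j) (Q j)

  three-term-at : ∀ i → suc (suc i) ℕ.≤ k →
                  (p i + p (suc (suc i)) ≡ c i * p (suc i)) × (Q i + Q (suc (suc i)) ≡ c i * Q (suc i))
  three-term-at i h = three-term (p i) (Q i) (p (suc i)) (Q (suc i)) (p (suc (suc i))) (Q (suc (suc i)))
                                 (det i (ℕ.<⇒≤ h)) (det (suc i) h)

  D-recurrence : ∀ i → suc (suc i) ℕ.≤ k → D i + D (suc (suc i)) ≡ c i * D (suc i)
  D-recurrence i h = begin
    D i + D (suc (suc i))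
      ≡⟨ collect (↥ x) (↧ x) (p i) (Q i) (p (suc (suc i))) (Q (suc (suc i))) ⟩
    ↥ x * (Q i + Q (suc (suc i))) - (p i + p (suc (suc i))) * ↧ x
      ≡⟨ cong₂ (λ s t → ↥ x * s - t * ↧ x) (proj₂ (three-term-at i h)) (proj₁ (three-term-at i h)) ⟩
    ↥ x * (c i * Q (suc i)) - c i * p (suc i) * ↧ x
      ≡⟨ factor (↥ x) (↧ x) (c i) (p (suc i)) (Q (suc i)) ⟩
    c i * D (suc i)
      ∎
    where
    collect : ∀ a b p₀ q₀ p₂ q₂ → (a * q₀ - p₀ * b) + (a * q₂ - p₂ * b) ≡ a * (q₀ + q₂) - (p₀ + p₂) * b
    collect = solve-∀
    factor : ∀ a b c p q → a * (c * q) - c * p * b ≡ c * (a * q - p * b)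
    factor = solve-∀
    open ≡-Reasoning

  2≤c : ∀ i → suc (suc i) ℕ.≤ k → + 2 ≤ c i
  2≤c i h = i<j⇒suc[i]≤j (*-cancelʳ-<-nonNeg {1ℤ} {c i} (Q (suc i)) (begin-strict
    1ℤ * Q (suc i)         ≡⟨ *-identityˡ (Q (suc i)) ⟩
    Q (suc i)              <⟨ +<+ (decr i (ℕ.<⇒≤ h)) ⟩
    Q i                    ≤⟨ i≤i+j (Q i) (Q (suc (suc i))) ⟩
    Q i + Q (suc (suc i))  ≡⟨ proj₂ (three-term-at i h) ⟩
    c i * Q (suc i)        ∎))
    where open ≤-Reasoning

  D≡det₂ : ∀ j → D j ≡ det₂ (p 0) (Q 0) (p j) (Q j)
  D≡det₂ j = cong₂ (λ a b → det₂ a b (p j) (Q j)) (sym start-p) (cong +_ (sym start-q))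

  D-nonnegative-increasing : ∀ i → suc i ℕ.≤ k → 0ℤ ≤ D i × D i < D (suc i)
  D-nonnegative-increasing zero h =
    ≤-reflexive (sym D₀≡0) , subst₂ _<_ (sym D₀≡0) (sym D₁≡1) (+<+ ℕ.z<s)
    where
    D₀≡0 : D 0 ≡ 0ℤ
    D₀≡0 = trans (D≡det₂ 0) (+-inverseʳ (p 0 * Q 0))
    D₁≡1 : D 1 ≡ 1ℤ
    D₁≡1 = trans (D≡det₂ 1) (det 0 h)
  D-nonnegative-increasing (suc i) h with D-nonnegative-increasing i (ℕ.<⇒≤ h)
  ... | 0≤Dᵢ , Dᵢ<Dᵢ₊₁ =
    ≤-trans 0≤Dᵢ (<⇒≤ Dᵢ<Dᵢ₊₁) , recurrence-increasing (2≤c i h) 0≤Dᵢ Dᵢ<Dᵢ₊₁ (D-recurrence i h)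

  x<slope : ∀ i → suc i ℕ.≤ k → x ℚ.< ℤ→ℚ (p i - p (suc i)) ÷' ℤ→ℚ (Q i - Q (suc i))
  x<slope i h = <-cross x (ℤ→ℚ M ÷' ℤ→ℚ N) {M} {N} 0<N
    (÷'-cross (ℤ→ℚ M) (ℤ→ℚ N) (toℚᵘ-ℤ→ℚ M) (toℚᵘ-ℤ→ℚ N) (≢-sym (<⇒≢ 0<N)))
    (+-cancelˡ-< (D i) (begin-strict
      D i + ↥ x * N        <⟨ +-monoˡ-< (↥ x * N) (proj₂ (D-nonnegative-increasing i h)) ⟩
      D (suc i) + ↥ x * N  ≡⟨ shift (↥ x) (↧ x) (p i) (Q i) (p (suc i)) (Q (suc i)) ⟩
      D i + M * ↧ x        ∎))
    where
    shift : ∀ a b p q p′ q′ → (a * q′ - p′ * b) + a * (q - q′) ≡ (a * q - p * b) + (p - p′) * b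
    shift = solve-∀
    open ≤-Reasoning
    M = p i - p (suc i)
    N = Q i - Q (suc i)
    0<N : 0ℤ < N
    0<N = i<j⇒0<j-i (+<+ (decr i h))

  ⌈ratio⌉≡c : ∀ i → suc (suc i) ℕ.≤ k →
              ceiling ((x ℚ.* ℤ→ℚ (Q (suc (suc i))) ℚ.- ℤ→ℚ (p (suc (suc i))))
                       ÷' (x ℚ.* ℤ→ℚ (Q (suc i)) ℚ.- ℤ→ℚ (p (suc i))))
                ≡ c i
  ⌈ratio⌉≡c i h = ceiling-cross r {D (suc (suc i))} {D (suc i)} {D i} (c i) cross
    (trans (+-comm (D (suc (suc i))) (D i)) (D-recurrence i h)) 0≤Dᵢ Dᵢ<Dᵢ₊₁
    where
    0≤Dᵢ : 0ℤ ≤ D i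
    0≤Dᵢ = proj₁ (D-nonnegative-increasing i (ℕ.<⇒≤ h))
    Dᵢ<Dᵢ₊₁ : D i < D (suc i)
    Dᵢ<Dᵢ₊₁ = proj₂ (D-nonnegative-increasing i (ℕ.<⇒≤ h))
    r : ℚ.ℚ
    r = (x ℚ.* ℤ→ℚ (Q (suc (suc i))) ℚ.- ℤ→ℚ (p (suc (suc i))))
        ÷' (x ℚ.* ℤ→ℚ (Q (suc i)) ℚ.- ℤ→ℚ (p (suc i)))
    cross : ↥ r * D (suc i) ≡ D (suc (suc i)) * ↧ r
    cross = ÷'-cross _ _ (toℚᵘ-affine x (Q (suc (suc i))) (p (suc (suc i))))
                         (toℚᵘ-affine x (Q (suc i)) (p (suc i)))
                         (≢-sym (<⇒≢ (≤-<-trans 0≤Dᵢ Dᵢ<Dᵢ₊₁)))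

open import Data.Integer using (ℤ; +_)
open import Data.Rational using (ℚ; 0ℚ; _<_; _*_; _-_; ceiling)
open import Data.Product using (_×_; _,_)
open import Relation.Binary.PropositionalEquality using (_≡_)

lemma2p7 : (x : ℚ) → 0ℚ < x → (k : ℕ) (p : ℕ → ℤ) (q : ℕ → ℕ) → MinimalPartition x k p q →
    -- (i) for j = i+1 ∈ {1..k}
    ((i : ℕ) → suc i Data.Nat.≤ k →
      x < (ℤ→ℚ (p i Data.Integer.- p (suc i)) ÷' ℤ→ℚ (+ q i Data.Integer.- + q (suc i))))
  × -- (ii) for j = i+1 ∈ {1..k-1}
    ((i : ℕ) → suc (suc i) Data.Nat.≤ k →
      ⌈ (x * ℤ→ℚ (+ q (suc (suc i))) - ℤ→ℚ (p (suc (suc i))))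
          ÷' (x * ℤ→ℚ (+ q (suc i)) - ℤ→ℚ (p (suc i))) ⌉
        ≡ p i Data.Integer.* + q (suc (suc i)) Data.Integer.- p (suc (suc i)) Data.Integer.* + q i)
lemma2p7 x _ k p q mp = x<slope , ⌈ratio⌉≡c
  where open MinimalPartitionProperties mp
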